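{- For every closed monitor $m$, every finite trace $s \in \mathit{Act}^*$ and every verdict $v$, we have $m \overset{s}{\Longrightarrow}_O v$ if and only if $m \overset{s}{\Longrightarrow}_N v$.
   Context: Monitors are generated by the grammar $m,n ::= v \mid a.m \mid m+n \mid \mathsf{rec}\,x.m \mid x \mid m \otimes n \mid m \oplus n$ with verdicts $v \in \{\mathsf{end}, \mathsf{no}, \mathsf{yes}\}$ (inconclusive, rejection, acceptance), actions $a \in \mathit{Act}$ (a finite set of external actions) and a distinguished internal action $\tau \notin \mathit{Act}$; $\otimes$ is conjunctive parallel composition and $\oplus$ disjunctive parallel composition. "System O" is the transition system given by the rules: $a.m \xrightarrow{a} m$; $\mathsf{rec}\,x.m \xrightarrow{\tau} m[\mathsf{rec}\,x.m/x]$; if $m \xrightarrow{\mu} m'$ then $m+n \xrightarrow{\mu} m'$ and $n+m \xrightarrow{\mu} m'$ (for $\mu \in \mathit{Act}\cup\{\tau\}$); $v \xrightarrow{a} v$ for every verdict $v$ and $a\in\mathit{Act}$; for $\odot \in \{\otimes,\oplus\}$: if $m \xrightarrow{a} m'$ and $n \xrightarrow{a} n'$ then $m\odot n \xrightarrow{a} m'\odot n'$; if $m \xrightarrow{\tau} m'$ then $m\odot n \xrightarrow{\tau} m'\odot n$ and $n\odot m \xrightarrow{\tau} n\odot m'$; $\mathsf{end}\odot\mathsf{end} \xrightarrow{\tau} \mathsf{end}$; $\mathsf{yes}\otimes m \xrightarrow{\tau} m$; $\mathsf{no}\otimes m \xrightarrow{\tau} \mathsf{no}$; $\mathsf{no}\oplus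 m \xrightarrow{\tau} m$; $\mathsf{yes}\oplus m \xrightarrow{\tau} \mathsf{yes}$ (together with the symmetric versions of these last four rules). "System N" is obtained from System O by replacing the rule $\mathsf{rec}\,x.m \xrightarrow{\tau} m[\mathsf{rec}\,x.m/x]$ with the two rules $\mathsf{rec}\,x.m_x \xrightarrow{\tau} m_x$ and $x \xrightarrow{\tau} m_x$, where it is assumed that for every monitor variable $x$ there is a unique (fixed) monitor $p_x = \mathsf{rec}\,x.m_x$ such that $x$ appears in $m_x$, and $p_x$ is the only monitor of the form $\mathsf{rec}\,x.m$ allowed. Subscripts $O$ and $N$ indicate the system used. Weak transitions: $m \Rightarrow m'$ means $m (\xrightarrow{\tau})^* m'$; $m \overset{a}{\Longrightarrow} m'$ means $m \Rightarrow \cdot \xrightarrow{a} \cdot \Rightarrow m'$; and $m \overset{s}{\Longrightarrow} m'$ for $s = a_1\cdots a_n$ is the composition $m \overset{a_1}{\Longrightarrow}\cdots\overset{a_n}{\Longrightarrow} m'$. -}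

module Defs where

open import Data.Nat using (ℕ; _≟_)
open import Data.Fin using (Fin)
open import Data.List using (List; []; _∷_)
open import Data.Bool using (if_then_else_)
open import Data.Product using (Σ; _×_; _,_)
open import Relation.Nullary using (¬_; does)
open import Relation.Binary.PropositionalEquality using (_≡_)
open import Relation.Binary.Construct.Closure.ReflexiveTransitive using (Star)

Var : Set
Var = ℕ

-- Verdicts: end (inconclusive), no (rejection), yes (acceptance)
data Verdict : Set where
  end no yes : Verdict

data Mon (A : Set) : Set where
  verd : Verdict → Mon A
  _∙_  : A → Mon A → Mon A
  _+_  : Mon A → Mon A → Mon A
  rec  : Var → Mon A → Mon A
  var  : Var → Mon A
  _⊗_  : Mon A → Mon A → Mon A
  _⊕_  : Mon A → Mon A → Mon A

data Lab (A : Set) : Set where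
  act : A → Lab A
  τ   : Lab A

data FreeIn {A : Set} (x : Var) : Mon A → Set where
  here : FreeIn x (var x)
  pre  : ∀ {a m} → FreeIn x m → FreeIn x (a ∙ m)
  +ˡ   : ∀ {m n} → FreeIn x m → FreeIn x (m + n)
  +ʳ   : ∀ {m n} → FreeIn x n → FreeIn x (m + n)
  ⊗ˡ   : ∀ {m n} → FreeIn x m → FreeIn x (m ⊗ n)
  ⊗ʳ   : ∀ {m n} → FreeIn x n → FreeIn x (m ⊗ n)
  ⊕ˡ   : ∀ {m n} → FreeIn x m → FreeIn x (m ⊕ n)
  ⊕ʳ   : ∀ {m n} → FreeIn x n → FreeIn x (m ⊕ n)
  recᶠ : ∀ {y m} → ¬ (x ≡ y) → FreeIn x m → FreeIn x (rec y m)

Closed : {A : Set} → Mon A → Set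
Closed m = ∀ x → ¬ FreeIn x m

_[_/_] : {A : Set} → Mon A → Mon A → Var → Mon A
verd v  [ p / x ] = verd v
(a ∙ m) [ p / x ] = a ∙ (m [ p / x ])
(m + n) [ p / x ] = (m [ p / x ]) + (n [ p / x ])
rec y m [ p / x ] = if does (x ≟ y) then rec y m else rec y (m [ p / x ])
var y   [ p / x ] = if does (x ≟ y) then p else var y
(m ⊗ n) [ p / x ] = (m [ p / x ]) ⊗ (n [ p / x ])
(m ⊕ n) [ p / x ] = (m [ p / x ]) ⊕ (n [ p / x ])

-- Generic LTS, parametrised by the rule(s) for recursion (τ-steps R).
data Step {A : Set} (R : Mon A → Mon A → Set) : Mon A → Lab A → Mon A → Set where
  recR   : ∀ {m m'} → R m m' → Step R m τ m'
  actR   : ∀ {a m} → Step R (a ∙ m) (act a) m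
  sumL   : ∀ {m n μ m'} → Step R m μ m' → Step R (m + n) μ m'
  sumR   : ∀ {m n μ m'} → Step R m μ m' → Step R (n + m) μ m'
  verdR  : ∀ {v a} → Step R (verd v) (act a) (verd v)
  ⊗sync  : ∀ {m n m' n' a} → Step R m (act a) m' → Step R n (act a) n' →
           Step R (m ⊗ n) (act a) (m' ⊗ n')
  ⊗τL    : ∀ {m n m'} → Step R m τ m' → Step R (m ⊗ n) τ (m' ⊗ n)
  ⊗τR    : ∀ {m n m'} → Step R m τ m' → Step R (n ⊗ m) τ (n ⊗ m')
  ⊗end   : Step R (verd end ⊗ verd end) τ (verd end)
  ⊗yesL  : ∀ {m} → Step R (verd yes ⊗ m) τ m
  ⊗yesR  : ∀ {m} → Step R (m ⊗ verd yes) τ m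
  ⊗noL   : ∀ {m} → Step R (verd no ⊗ m) τ (verd no)
  ⊗noR   : ∀ {m} → Step R (m ⊗ verd no) τ (verd no)
  ⊕sync  : ∀ {m n m' n' a} → Step R m (act a) m' → Step R n (act a) n' →
           Step R (m ⊕ n) (act a) (m' ⊕ n')
  ⊕τL    : ∀ {m n m'} → Step R m τ m' → Step R (m ⊕ n) τ (m' ⊕ n)
  ⊕τR    : ∀ {m n m'} → Step R m τ m' → Step R (n ⊕ m) τ (n ⊕ m')
  ⊕end   : Step R (verd end ⊕ verd end) τ (verd end)
  ⊕noL   : ∀ {m} → Step R (verd no ⊕ m) τ m
  ⊕noR   : ∀ {m} → Step R (m ⊕ verd no) τ m
  ⊕yesL  : ∀ {m} → Step R (verd yes ⊕ m) τ (verd yes)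
  ⊕yesR  : ∀ {m} → Step R (m ⊕ verd yes) τ (verd yes)

data WeakTr {A : Set} (R : Mon A → Mon A → Set) : Mon A → List A → Mon A → Set where
  done : ∀ {m m'} → Star (λ p q → Step R p τ q) m m' → WeakTr R m [] m'
  cons : ∀ {m m₁ m₂ m₃ a s} →
         Star (λ p q → Step R p τ q) m m₁ → Step R m₁ (act a) m₂ →
         WeakTr R m₂ s m₃ → WeakTr R m (a ∷ s) m₃

data RecO {A : Set} : Mon A → Mon A → Set where
  unfold : ∀ {x m} → RecO (rec x m) (m [ rec x m / x ])

-- Convention of System N: every rec-subterm rec y n of a monitor has n ≡ body y
data WF {A : Set} (body : Var → Mon A) : Mon A → Set where
  verdW : ∀ {v} → WF body (verd v)
  preW  : ∀ {a m} → WF body m → WF body (a ∙ m)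
  +W    : ∀ {m n} → WF body m → WF body n → WF body (m + n)
  ⊗W    : ∀ {m n} → WF body m → WF body n → WF body (m ⊗ n)
  ⊕W    : ∀ {m n} → WF body m → WF body n → WF body (m ⊕ n)
  varW  : ∀ {x} → WF body (var x)
  recW  : ∀ {x} → WF body (body x) → WF body (rec x (body x))

-- Fixed assignment x ↦ p_x = rec x.m_x, with x occurring in m_x,
-- and p_x the only rec x-monitor allowed (so the bodies obey the convention too).
record RecEnv (A : Set) : Set where
  field
    body     : Var → Mon A
    occurs   : ∀ x → FreeIn x (body x)
    bodiesWF : ∀ x → WF body (body x)

data RecN {A : Set} (E : RecEnv A) : Mon A → Mon A → Set where
  unfoldN : ∀ {x} → RecN E (rec x (RecEnv.body E x)) (RecEnv.body E x)
  varN    : ∀ {x} → RecN E (var x) (RecEnv.body E x)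

StepO : {A : Set} → Mon A → Lab A → Mon A → Set
StepO = Step RecO

StepN : {A : Set} → RecEnv A → Mon A → Lab A → Mon A → Set
StepN E = Step (RecN E)

_=[_]⇒O_ : {A : Set} → Mon A → List A → Mon A → Set
m =[ s ]⇒O m' = WeakTr RecO m s m'

WeakN : {A : Set} → RecEnv A → Mon A → List A → Mon A → Set
WeakN E m s m' = WeakTr (RecN E) m s m'

module Submission where

open import Defs hiding (yes; no)
open import Level using (0ℓ)
open import Data.Nat using (ℕ; _≟_; _≡ᵇ_)
open import Data.Fin using (Fin)
open import Data.List using (List)
open import Data.Product using (_×_; ∃; _,_)
open import Data.Sum using (inj₁; inj₂; [_,_]; map₂)
open import Function using (_∘_)
open import Data.Empty using (⊥; ⊥-elim)
open import Data.Unit using (⊤; tt)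
open import Data.Bool using (true; false)
open import Relation.Nullary using (yes; no; proof)
open import Relation.Nullary.Reflects using (ofʸ; ofⁿ)
open import Relation.Unary using (Pred; ∅; ｛_｝; _∪_; _⊆_)
open import Relation.Binary.PropositionalEquality using (_≡_; refl; sym; trans; subst; cong; cong₂)
open import Relation.Binary.Construct.Closure.ReflexiveTransitive using (Star; ε; _◅_)

-- Erase every recursion node rec x.b to the variable x. In the erased system the
-- only recursion rule is x →τ erase(m_x), and every other rule acts on erased
-- monitors exactly as on the original ones. Both System O (on monitors reachable
-- from a closed one) and System N (on monitors obeying the rec-convention) are in
-- step-for-step correspondence with the erased system: an O-unfolding of
-- rec x.b yields b[rec x.b/x], whose erasure is erase(b) = erase(m_x), while an
-- N-step from rec x.m_x or x yields m_x. Hence monitors with the same erasure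
-- simulate each other, and only a verdict erases to a verdict.

τ-Star : {A : Set} → (Mon A → Mon A → Set) → Mon A → Mon A → Set
τ-Star R = Star (λ p q → Step R p τ q)

module _ {A : Set} where

  erase : Mon A → Mon A
  erase (verd v)  = verd v
  erase (a ∙ m)   = a ∙ erase m
  erase (m + n)   = erase m + erase n
  erase (rec x _) = var x
  erase (var x)   = var x
  erase (m ⊗ n)   = erase m ⊗ erase n
  erase (m ⊕ n)   = erase m ⊕ erase n

  erase≡verd : ∀ {m v} → erase m ≡ verd v → m ≡ verd v
  erase≡verd {verd _} refl = refl
  erase≡verd {_ ∙ _} ()
  erase≡verd {_ + _} ()
  erase≡verd {rec _ _} ()
  erase≡verd {var _} ()
  erase≡verd {_ ⊗ _} ()
  erase≡verd {_ ⊕ _} ()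

  erase-[/] : ∀ {p x} → erase p ≡ var x → ∀ b → erase (b [ p / x ]) ≡ erase b
  erase-[/] ep (verd v) = refl
  erase-[/] ep (a ∙ b)  = cong (a ∙_) (erase-[/] ep b)
  erase-[/] ep (b + c)  = cong₂ _+_ (erase-[/] ep b) (erase-[/] ep c)
  erase-[/] ep (b ⊗ c)  = cong₂ _⊗_ (erase-[/] ep b) (erase-[/] ep c)
  erase-[/] ep (b ⊕ c)  = cong₂ _⊕_ (erase-[/] ep b) (erase-[/] ep c)
  -- Substitution tests does (x ≟ y), which computes to x ≡ᵇ y; so that test is
  -- abstracted together with its proof of reflection.
  erase-[/] {x = x} ep (rec y b) with x ≡ᵇ y
  ... | true  = refl
  ... | false = refl
  erase-[/] {x = x} ep (var y) with x ≡ᵇ y | proof (x ≟ y)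
  ... | true  | ofʸ refl = ep
  ... | false | _        = refl

module WeakSimulation {A : Set} {R₁ R₂ : Mon A → Mon A → Set}
  (_~_ : Mon A → Mon A → Set)
  (simulate : ∀ {t₁ t₂ μ u₁} → t₁ ~ t₂ → Step R₁ t₁ μ u₁ →
              ∃ λ u₂ → Step R₂ t₂ μ u₂ × u₁ ~ u₂)
  (~-verd : ∀ {v t} → verd v ~ t → t ≡ verd v)
  where

  τ*-simulate : ∀ {t₁ t₂ u₁} → t₁ ~ t₂ → τ-Star R₁ t₁ u₁ →
                ∃ λ u₂ → τ-Star R₂ t₂ u₂ × u₁ ~ u₂
  τ*-simulate t~ ε = _ , ε , t~
  τ*-simulate t~ (st ◅ sts) with simulate t~ st
  ... | _ , st₂ , u~ with τ*-simulate u~ sts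
  ... | _ , sts₂ , w~ = _ , st₂ ◅ sts₂ , w~

  weak-simulate : ∀ {t₁ t₂ s v} → t₁ ~ t₂ → WeakTr R₁ t₁ s (verd v) → WeakTr R₂ t₂ s (verd v)
  weak-simulate t~ (done sts) with τ*-simulate t~ sts
  ... | _ , sts₂ , v~ with ~-verd v~
  ... | refl = done sts₂
  weak-simulate t~ (cons sts st w) with τ*-simulate t~ sts
  ... | _ , sts₂ , u~ with simulate u~ st
  ... | _ , st₂ , w~ = cons sts₂ st₂ (weak-simulate w~ w)

module Erased {A : Set} (body : Var → Mon A) where

  data UnfoldErased : Mon A → Mon A → Set where
    unfoldE : ∀ {x} → UnfoldErased (var x) (erase (body x))

  IsRecNode : Mon A → Set
  IsRecNode (rec _ _) = ⊤
  IsRecNode (var _)   = ⊤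
  IsRecNode _         = ⊥

  -- Only the outermost rec- and variable nodes are constrained: rec bodies are not entered.
  data AtRecNodes (Q : Pred (Mon A) 0ℓ) : Mon A → Set where
    verdᴬ : ∀ {v} → AtRecNodes Q (verd v)
    preᴬ  : ∀ {a m} → AtRecNodes Q m → AtRecNodes Q (a ∙ m)
    +ᴬ    : ∀ {m n} → AtRecNodes Q m → AtRecNodes Q n → AtRecNodes Q (m + n)
    ⊗ᴬ    : ∀ {m n} → AtRecNodes Q m → AtRecNodes Q n → AtRecNodes Q (m ⊗ n)
    ⊕ᴬ    : ∀ {m n} → AtRecNodes Q m → AtRecNodes Q n → AtRecNodes Q (m ⊕ n)
    recᴬ  : ∀ {x b} → Q (rec x b) → AtRecNodes Q (rec x b)
    varᴬ  : ∀ {x} → Q (var x) → AtRecNodes Q (var x)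

  record ErasureSimulation : Set₁ where
    field
      Rule          : Mon A → Mon A → Set
      Inv           : Pred (Mon A) 0ℓ
      Rule-recNode  : ∀ {t t'} → Rule t t' → IsRecNode t
      Rule-erase    : ∀ {t t'} → Inv t → Rule t t' → UnfoldErased (erase t) (erase t')
      Rule-unerase  : ∀ {t e'} → Inv t → UnfoldErased (erase t) e' →
                      ∃ λ t' → Rule t t' × erase t' ≡ e'
      Rule-preserve : ∀ {t t'} → Inv t → Rule t t' → AtRecNodes Inv t'

  module Steps (S : ErasureSimulation) where
    open ErasureSimulation S

    Step-erase : ∀ {t μ t'} → AtRecNodes Inv t → Step Rule t μ t' →
                 Step UnfoldErased (erase t) μ (erase t')
    Step-erase verdᴬ verdR = verdR
    Step-erase (preᴬ _) actR = actR
    Step-erase (+ᴬ i _) (sumL st) = sumL (Step-erase i st)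
    Step-erase (+ᴬ _ j) (sumR st) = sumR (Step-erase j st)
    Step-erase (⊗ᴬ i j) (⊗sync st st') = ⊗sync (Step-erase i st) (Step-erase j st')
    Step-erase (⊗ᴬ i _) (⊗τL st) = ⊗τL (Step-erase i st)
    Step-erase (⊗ᴬ _ j) (⊗τR st) = ⊗τR (Step-erase j st)
    Step-erase (⊗ᴬ _ _) ⊗end = ⊗end
    Step-erase (⊗ᴬ _ _) ⊗yesL = ⊗yesL
    Step-erase (⊗ᴬ _ _) ⊗yesR = ⊗yesR
    Step-erase (⊗ᴬ _ _) ⊗noL = ⊗noL
    Step-erase (⊗ᴬ _ _) ⊗noR = ⊗noR
    Step-erase (⊕ᴬ i j) (⊕sync st st') = ⊕sync (Step-erase i st) (Step-erase j st')
    Step-erase (⊕ᴬ i _) (⊕τL st) = ⊕τL (Step-erase i st)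
    Step-erase (⊕ᴬ _ j) (⊕τR st) = ⊕τR (Step-erase j st)
    Step-erase (⊕ᴬ _ _) ⊕end = ⊕end
    Step-erase (⊕ᴬ _ _) ⊕noL = ⊕noL
    Step-erase (⊕ᴬ _ _) ⊕noR = ⊕noR
    Step-erase (⊕ᴬ _ _) ⊕yesL = ⊕yesL
    Step-erase (⊕ᴬ _ _) ⊕yesR = ⊕yesR
    Step-erase (recᴬ q) (recR r) = recR (Rule-erase q r)
    Step-erase (varᴬ q) (recR r) = recR (Rule-erase q r)
    Step-erase verdᴬ (recR r) = ⊥-elim (Rule-recNode r)
    Step-erase (preᴬ _) (recR r) = ⊥-elim (Rule-recNode r)
    Step-erase (+ᴬ _ _) (recR r) = ⊥-elim (Rule-recNode r)
    Step-erase (⊗ᴬ _ _) (recR r) = ⊥-elim (Rule-recNode r)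
    Step-erase (⊕ᴬ _ _) (recR r) = ⊥-elim (Rule-recNode r)

    Step-preserve : ∀ {t μ t'} → AtRecNodes Inv t → Step Rule t μ t' → AtRecNodes Inv t'
    Step-preserve verdᴬ verdR = verdᴬ
    Step-preserve (preᴬ i) actR = i
    Step-preserve (+ᴬ i _) (sumL st) = Step-preserve i st
    Step-preserve (+ᴬ _ j) (sumR st) = Step-preserve j st
    Step-preserve (⊗ᴬ i j) (⊗sync st st') = ⊗ᴬ (Step-preserve i st) (Step-preserve j st')
    Step-preserve (⊗ᴬ i j) (⊗τL st) = ⊗ᴬ (Step-preserve i st) j
    Step-preserve (⊗ᴬ i j) (⊗τR st) = ⊗ᴬ i (Step-preserve j st)
    Step-preserve (⊗ᴬ _ _) ⊗end = verdᴬ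
    Step-preserve (⊗ᴬ _ j) ⊗yesL = j
    Step-preserve (⊗ᴬ i _) ⊗yesR = i
    Step-preserve (⊗ᴬ _ _) ⊗noL = verdᴬ
    Step-preserve (⊗ᴬ _ _) ⊗noR = verdᴬ
    Step-preserve (⊕ᴬ i j) (⊕sync st st') = ⊕ᴬ (Step-preserve i st) (Step-preserve j st')
    Step-preserve (⊕ᴬ i j) (⊕τL st) = ⊕ᴬ (Step-preserve i st) j
    Step-preserve (⊕ᴬ i j) (⊕τR st) = ⊕ᴬ i (Step-preserve j st)
    Step-preserve (⊕ᴬ _ _) ⊕end = verdᴬ
    Step-preserve (⊕ᴬ _ j) ⊕noL = j
    Step-preserve (⊕ᴬ i _) ⊕noR = i
    Step-preserve (⊕ᴬ _ _) ⊕yesL = verdᴬ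
    Step-preserve (⊕ᴬ _ _) ⊕yesR = verdᴬ
    Step-preserve (recᴬ q) (recR r) = Rule-preserve q r
    Step-preserve (varᴬ q) (recR r) = Rule-preserve q r
    Step-preserve verdᴬ (recR r) = ⊥-elim (Rule-recNode r)
    Step-preserve (preᴬ _) (recR r) = ⊥-elim (Rule-recNode r)
    Step-preserve (+ᴬ _ _) (recR r) = ⊥-elim (Rule-recNode r)
    Step-preserve (⊗ᴬ _ _) (recR r) = ⊥-elim (Rule-recNode r)
    Step-preserve (⊕ᴬ _ _) (recR r) = ⊥-elim (Rule-recNode r)

    Unerased : Mon A → Lab A → Mon A → Set
    Unerased t μ e' = ∃ λ t' → Step Rule t μ t' × erase t' ≡ e'

    -- The erasures of the two components are kept as separate equations, so that
    -- the verdict rules can be matched against them via erase≡verd.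
    Step-unerase : ∀ {t e μ e'} → AtRecNodes Inv t → erase t ≡ e →
                   Step UnfoldErased e μ e' → Unerased t μ e'
    Step-unerase-⊗ : ∀ {t₁ t₂ e₁ e₂ μ e'} → AtRecNodes Inv t₁ → AtRecNodes Inv t₂ →
                     erase t₁ ≡ e₁ → erase t₂ ≡ e₂ →
                     Step UnfoldErased (e₁ ⊗ e₂) μ e' → Unerased (t₁ ⊗ t₂) μ e'
    Step-unerase-⊕ : ∀ {t₁ t₂ e₁ e₂ μ e'} → AtRecNodes Inv t₁ → AtRecNodes Inv t₂ →
                     erase t₁ ≡ e₁ → erase t₂ ≡ e₂ →
                     Step UnfoldErased (e₁ ⊕ e₂) μ e' → Unerased (t₁ ⊕ t₂) μ e'

    Step-unerase verdᴬ refl verdR = _ , verdR , refl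
    Step-unerase (preᴬ _) refl actR = _ , actR , refl
    Step-unerase (+ᴬ i _) refl (sumL st) with Step-unerase i refl st
    ... | _ , st' , eq = _ , sumL st' , eq
    Step-unerase (+ᴬ _ j) refl (sumR st) with Step-unerase j refl st
    ... | _ , st' , eq = _ , sumR st' , eq
    Step-unerase (⊗ᴬ i j) refl st = Step-unerase-⊗ i j refl refl st
    Step-unerase (⊕ᴬ i j) refl st = Step-unerase-⊕ i j refl refl st
    Step-unerase (recᴬ q) refl (recR r) with Rule-unerase q r
    ... | _ , r' , eq = _ , recR r' , eq
    Step-unerase (varᴬ q) refl (recR r) with Rule-unerase q r
    ... | _ , r' , eq = _ , recR r' , eq
    Step-unerase verdᴬ refl (recR ())
    Step-unerase (preᴬ _) refl (recR ())
    Step-unerase (+ᴬ _ _) refl (recR ())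

    Step-unerase-⊗ _ _ _ _ (recR ())
    Step-unerase-⊗ i j refl refl (⊗sync st st')
      with Step-unerase i refl st | Step-unerase j refl st'
    ... | _ , u , eq | _ , u' , eq' = _ , ⊗sync u u' , cong₂ _⊗_ eq eq'
    Step-unerase-⊗ {t₂ = t₂} i _ refl refl (⊗τL st) with Step-unerase i refl st
    ... | _ , u , eq = _ , ⊗τL u , cong (_⊗ erase t₂) eq
    Step-unerase-⊗ {t₁ = t₁} _ j refl refl (⊗τR st) with Step-unerase j refl st
    ... | _ , u , eq = _ , ⊗τR u , cong (erase t₁ ⊗_) eq
    Step-unerase-⊗ _ _ e₁ e₂ ⊗end with erase≡verd e₁ | erase≡verd e₂
    ... | refl | refl = _ , ⊗end , refl
    Step-unerase-⊗ _ _ e₁ e₂ ⊗yesL with erase≡verd e₁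
    ... | refl = _ , ⊗yesL , e₂
    Step-unerase-⊗ _ _ e₁ e₂ ⊗yesR with erase≡verd e₂
    ... | refl = _ , ⊗yesR , e₁
    Step-unerase-⊗ _ _ e₁ _ ⊗noL with erase≡verd e₁
    ... | refl = _ , ⊗noL , refl
    Step-unerase-⊗ _ _ _ e₂ ⊗noR with erase≡verd e₂
    ... | refl = _ , ⊗noR , refl

    Step-unerase-⊕ _ _ _ _ (recR ())
    Step-unerase-⊕ i j refl refl (⊕sync st st')
      with Step-unerase i refl st | Step-unerase j refl st'
    ... | _ , u , eq | _ , u' , eq' = _ , ⊕sync u u' , cong₂ _⊕_ eq eq'
    Step-unerase-⊕ {t₂ = t₂} i _ refl refl (⊕τL st) with Step-unerase i refl st
    ... | _ , u , eq = _ , ⊕τL u , cong (_⊕ erase t₂) eq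
    Step-unerase-⊕ {t₁ = t₁} _ j refl refl (⊕τR st) with Step-unerase j refl st
    ... | _ , u , eq = _ , ⊕τR u , cong (erase t₁ ⊕_) eq
    Step-unerase-⊕ _ _ e₁ e₂ ⊕end with erase≡verd e₁ | erase≡verd e₂
    ... | refl | refl = _ , ⊕end , refl
    Step-unerase-⊕ _ _ e₁ e₂ ⊕noL with erase≡verd e₁
    ... | refl = _ , ⊕noL , e₂
    Step-unerase-⊕ _ _ e₁ e₂ ⊕noR with erase≡verd e₂
    ... | refl = _ , ⊕noR , e₁
    Step-unerase-⊕ _ _ e₁ _ ⊕yesL with erase≡verd e₁
    ... | refl = _ , ⊕yesL , refl
    Step-unerase-⊕ _ _ _ e₂ ⊕yesR with erase≡verd e₂
    ... | refl = _ , ⊕yesR , refl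

  module Transfer (S₁ S₂ : ErasureSimulation) where
    open ErasureSimulation S₁ using () renaming (Rule to R₁; Inv to Inv₁)
    open ErasureSimulation S₂ using () renaming (Rule to R₂; Inv to Inv₂)
    module S₁ = Steps S₁
    module S₂ = Steps S₂

    data Related (t₁ t₂ : Mon A) : Set where
      related : AtRecNodes Inv₁ t₁ → AtRecNodes Inv₂ t₂ → erase t₁ ≡ erase t₂ → Related t₁ t₂

    Related-simulate : ∀ {t₁ t₂ μ u₁} → Related t₁ t₂ → Step R₁ t₁ μ u₁ →
                       ∃ λ u₂ → Step R₂ t₂ μ u₂ × Related u₁ u₂
    Related-simulate (related i₁ i₂ eq) st
      with S₂.Step-unerase i₂ (sym eq) (S₁.Step-erase i₁ st)
    ... | _ , st₂ , eq' = _ , st₂ , related (S₁.Step-preserve i₁ st) (S₂.Step-preserve i₂ st₂) (sym eq')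

    Related-verd : ∀ {v t} → Related (verd v) t → t ≡ verd v
    Related-verd (related _ _ eq) = erase≡verd (sym eq)

    open WeakSimulation Related Related-simulate Related-verd public
      using (weak-simulate)

module SystemO {A : Set} (body : Var → Mon A) where
  open Erased body

  -- The invariant of System O: Faithful ∅ holds for every O-derivative of a closed
  -- monitor obeying the rec-convention.
  data Faithful (X : Pred Var 0ℓ) : Mon A → Set where
    verdᶠ : ∀ {v} → Faithful X (verd v)
    preᶠ  : ∀ {a m} → Faithful X m → Faithful X (a ∙ m)
    +ᶠ    : ∀ {m n} → Faithful X m → Faithful X n → Faithful X (m + n)
    ⊗ᶠ    : ∀ {m n} → Faithful X m → Faithful X n → Faithful X (m ⊗ n)
    ⊕ᶠ    : ∀ {m n} → Faithful X m → Faithful X n → Faithful X (m ⊕ n)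
    varᶠ  : ∀ {x} → X x → Faithful X (var x)
    recᶠ  : ∀ {x b} → erase b ≡ erase (body x) → Faithful (｛ x ｝ ∪ X) b →
            Faithful X (rec x b)

  Faithful-mono : ∀ {X Y} → X ⊆ Y → Faithful X ⊆ Faithful Y
  Faithful-mono X⊆Y verdᶠ = verdᶠ
  Faithful-mono X⊆Y (preᶠ f) = preᶠ (Faithful-mono X⊆Y f)
  Faithful-mono X⊆Y (+ᶠ f g) = +ᶠ (Faithful-mono X⊆Y f) (Faithful-mono X⊆Y g)
  Faithful-mono X⊆Y (⊗ᶠ f g) = ⊗ᶠ (Faithful-mono X⊆Y f) (Faithful-mono X⊆Y g)
  Faithful-mono X⊆Y (⊕ᶠ f g) = ⊕ᶠ (Faithful-mono X⊆Y f) (Faithful-mono X⊆Y g)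
  Faithful-mono X⊆Y (varᶠ q) = varᶠ (X⊆Y q)
  Faithful-mono X⊆Y (recᶠ e f) = recᶠ e (Faithful-mono (map₂ X⊆Y) f)

  Faithful-[/] : ∀ {X Y p x b} → X ⊆ ｛ x ｝ ∪ Y → Faithful ∅ p → erase p ≡ var x →
                 Faithful X b → Faithful Y (b [ p / x ])
  Faithful-[/] X⊆ fp ep verdᶠ = verdᶠ
  Faithful-[/] X⊆ fp ep (preᶠ f) = preᶠ (Faithful-[/] X⊆ fp ep f)
  Faithful-[/] X⊆ fp ep (+ᶠ f g) = +ᶠ (Faithful-[/] X⊆ fp ep f) (Faithful-[/] X⊆ fp ep g)
  Faithful-[/] X⊆ fp ep (⊗ᶠ f g) = ⊗ᶠ (Faithful-[/] X⊆ fp ep f) (Faithful-[/] X⊆ fp ep g)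
  Faithful-[/] X⊆ fp ep (⊕ᶠ f g) = ⊕ᶠ (Faithful-[/] X⊆ fp ep f) (Faithful-[/] X⊆ fp ep g)
  Faithful-[/] {x = x} X⊆ fp ep (varᶠ {x = y} q) with x ≡ᵇ y | proof (x ≟ y) | X⊆ q
  ... | true  | ofʸ refl | _        = Faithful-mono (λ ()) fp
  ... | false | ofⁿ x≢y  | inj₁ x≡y = ⊥-elim (x≢y x≡y)
  ... | false | _        | inj₂ r   = varᶠ r
  Faithful-[/] {x = x} X⊆ fp ep (recᶠ {x = y} {b = c} e f) with x ≡ᵇ y | proof (x ≟ y)
  ... | true  | ofʸ refl = recᶠ e (Faithful-mono [ inj₁ , X⊆ ] f)
  ... | false | _        =
    recᶠ (trans (erase-[/] ep c) e) (Faithful-[/] [ inj₂ ∘ inj₁ , map₂ inj₂ ∘ X⊆ ] fp ep f)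

  WF⇒Faithful : ∀ {X t} → WF body t → (λ y → FreeIn y t) ⊆ X → Faithful X t
  WF⇒Faithful verdW fv = verdᶠ
  WF⇒Faithful (preW w) fv = preᶠ (WF⇒Faithful w (λ f → fv (pre f)))
  WF⇒Faithful (+W w w') fv = +ᶠ (WF⇒Faithful w (λ f → fv (+ˡ f))) (WF⇒Faithful w' (λ f → fv (+ʳ f)))
  WF⇒Faithful (⊗W w w') fv = ⊗ᶠ (WF⇒Faithful w (λ f → fv (⊗ˡ f))) (WF⇒Faithful w' (λ f → fv (⊗ʳ f)))
  WF⇒Faithful (⊕W w w') fv = ⊕ᶠ (WF⇒Faithful w (λ f → fv (⊕ˡ f))) (WF⇒Faithful w' (λ f → fv (⊕ʳ f)))
  WF⇒Faithful varW fv = varᶠ (fv here)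
  WF⇒Faithful {X} (recW {x = x} w) fv = recᶠ refl (WF⇒Faithful w bound)
    where
    bound : (λ z → FreeIn z (body x)) ⊆ ｛ x ｝ ∪ X
    bound {z} f with x ≟ z
    ... | yes x≡z = inj₁ x≡z
    ... | no x≢z  = inj₂ (fv (recᶠ (λ z≡x → x≢z (sym z≡x)) f))

  Faithful⇒AtRecNodes : ∀ {t} → Faithful ∅ t → AtRecNodes (Faithful ∅) t
  Faithful⇒AtRecNodes verdᶠ = verdᴬ
  Faithful⇒AtRecNodes (preᶠ f) = preᴬ (Faithful⇒AtRecNodes f)
  Faithful⇒AtRecNodes (+ᶠ f g) = +ᴬ (Faithful⇒AtRecNodes f) (Faithful⇒AtRecNodes g)
  Faithful⇒AtRecNodes (⊗ᶠ f g) = ⊗ᴬ (Faithful⇒AtRecNodes f) (Faithful⇒AtRecNodes g)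
  Faithful⇒AtRecNodes (⊕ᶠ f g) = ⊕ᴬ (Faithful⇒AtRecNodes f) (Faithful⇒AtRecNodes g)
  Faithful⇒AtRecNodes (varᶠ ())
  Faithful⇒AtRecNodes f@(recᶠ _ _) = recᴬ f

  systemO : ErasureSimulation
  systemO = record
    { Rule          = RecO
    ; Inv           = Faithful ∅
    ; Rule-recNode  = λ { unfold → tt }
    ; Rule-erase    = erase-unfold
    ; Rule-unerase  = unerase-unfold
    ; Rule-preserve = preserve-unfold
    }
    where
    erase-unfold : ∀ {t t'} → Faithful ∅ t → RecO t t' → UnfoldErased (erase t) (erase t')
    erase-unfold {rec x b} (recᶠ e _) unfold =
      subst (UnfoldErased (var x)) (sym (trans (erase-[/] refl b) e)) unfoldE

    unerase-unfold : ∀ {t e'} → Faithful ∅ t → UnfoldErased (erase t) e' →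
                     ∃ λ t' → RecO t t' × erase t' ≡ e'
    unerase-unfold {rec x b} (recᶠ e _) unfoldE = _ , unfold , trans (erase-[/] refl b) e

    preserve-unfold : ∀ {t t'} → Faithful ∅ t → RecO t t' → AtRecNodes (Faithful ∅) t'
    preserve-unfold f@(recᶠ _ fb) unfold =
      Faithful⇒AtRecNodes (Faithful-[/] (map₂ (λ ())) f refl fb)

module SystemN {A : Set} (E : RecEnv A) where
  open RecEnv E
  open Erased body

  WF⇒AtRecNodes : ∀ {t} → WF body t → AtRecNodes (WF body) t
  WF⇒AtRecNodes verdW = verdᴬ
  WF⇒AtRecNodes (preW w) = preᴬ (WF⇒AtRecNodes w)
  WF⇒AtRecNodes (+W w w') = +ᴬ (WF⇒AtRecNodes w) (WF⇒AtRecNodes w')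
  WF⇒AtRecNodes (⊗W w w') = ⊗ᴬ (WF⇒AtRecNodes w) (WF⇒AtRecNodes w')
  WF⇒AtRecNodes (⊕W w w') = ⊕ᴬ (WF⇒AtRecNodes w) (WF⇒AtRecNodes w')
  WF⇒AtRecNodes w@varW = varᴬ w
  WF⇒AtRecNodes w@(recW _) = recᴬ w

  systemN : ErasureSimulation
  systemN = record
    { Rule          = RecN E
    ; Inv           = WF body
    ; Rule-recNode  = λ { unfoldN → tt ; varN → tt }
    ; Rule-erase    = λ { _ unfoldN → unfoldE ; _ varN → unfoldE }
    ; Rule-unerase  = λ { (recW _) unfoldE → _ , unfoldN , refl ; varW unfoldE → _ , varN , refl }
    ; Rule-preserve = λ _ r → WF⇒AtRecNodes (target-WF r)
    }
    where
    target-WF : ∀ {t t'} → RecN E t t' → WF body t'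
    target-WF (unfoldN {x = x}) = bodiesWF x
    target-WF (varN {x = x}) = bodiesWF x

mainTheorem10 : (k : ℕ) (E : RecEnv (Fin k)) (m : Mon (Fin k)) →
    Closed m → WF (RecEnv.body E) m →
    (s : List (Fin k)) (v : Verdict) →
    ((m =[ s ]⇒O verd v) → WeakN E m s (verd v)) ×
    (WeakN E m s (verd v) → (m =[ s ]⇒O verd v))
mainTheorem10 k E m closed wf s v =
  O⇒N.weak-simulate (O⇒N.related atO atN refl) , N⇒O.weak-simulate (N⇒O.related atN atO refl)
  where
  open RecEnv E using (body)
  open Erased body using (AtRecNodes)
  open SystemO body using (systemO; Faithful; WF⇒Faithful; Faithful⇒AtRecNodes)
  open SystemN E using (systemN; WF⇒AtRecNodes)
  module O⇒N = Erased.Transfer body systemO systemN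
  module N⇒O = Erased.Transfer body systemN systemO

  atO : AtRecNodes (Faithful ∅) m
  atO = Faithful⇒AtRecNodes (WF⇒Faithful wf (λ {y} → closed y))

  atN : AtRecNodes (WF body) m
  atN = WF⇒AtRecNodes wf
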